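{- Let $G$ be any graph and $v_0$ any node of $G$. The projection of $P(G)$ onto the coordinates indexed by $V(G-v_0)$ equals $P(G-v_0)$.
   Context: For a graph $G$ with edge-node incidence matrix $M\in\{0,1\}^{E(G)\times V(G)}$, $P(G):=\operatorname{conv}\{x\in\mathbb{Z}^{V(G)}\mid Mx\le\mathbf{1}\}$, i.e. the convex hull of integer vectors $x$ with $x_v+x_w\le1$ for every edge $vw$.
   Formalization: Points of P(G), of P(G−v0) and of the fibres of the projection have rational coordinates, and the convex combinations defining P(G) and P(G−v0) have rational coefficients. -}

module Defs where

open import Data.Nat using (ℕ; suc)
open import Data.Fin using (Fin; punchIn)
open import Data.Bool using (Bool; true)
open import Data.Integer as ℤ using (ℤ)
open import Data.Rational as ℚ using (ℚ)
open import Data.List using (List; map; foldr)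
open import Data.List.Relation.Unary.All using (All)
open import Data.Product using (Σ; _×_; proj₁; proj₂)
open import Relation.Binary.PropositionalEquality using (_≡_)
open import Relation.Nullary using (¬_)

Graph : ℕ → Set
Graph n = Fin n → Fin n → Bool

IsSimple : ∀ {n} → Graph n → Set
IsSimple {n} E = (∀ v → ¬ (E v v ≡ true)) × (∀ v w → E v w ≡ true → E w v ≡ true)

-- Integer vectors x ∈ ℤ^V with M x ≤ 1, i.e. x_v + x_w ≤ 1 for every edge vw.
Feasible : ∀ {n} → Graph n → (Fin n → ℤ) → Set
Feasible E x = ∀ v w → E v w ≡ true → (x v ℤ.+ x w) ℤ.≤ ℤ.+ 1

sumℚ : List ℚ → ℚ
sumℚ = foldr ℚ._+_ ℚ.0ℚ

InConv : ∀ {n} → ((Fin n → ℤ) → Set) → (Fin n → ℚ) → Set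
InConv {n} S y =
  Σ (List (ℚ × (Fin n → ℤ))) λ cs →
      All (λ c → ℚ.0ℚ ℚ.≤ proj₁ c) cs
    × All (λ c → S (proj₂ c)) cs
    × sumℚ (map proj₁ cs) ≡ ℚ.1ℚ
    × (∀ i → y i ≡ sumℚ (map (λ c → proj₁ c ℚ.* (proj₂ c i ℚ./ 1)) cs))

P : ∀ {n} → Graph n → (Fin n → ℚ) → Set
P E = InConv (Feasible E)

delete : ∀ {n} → Graph (suc n) → Fin (suc n) → Graph n
delete E v0 i j = E (punchIn v0 i) (punchIn v0 j)

project : ∀ {n} → Fin (suc n) → (Fin (suc n) → ℚ) → (Fin n → ℚ)
project v0 x i = x (punchIn v0 i)

{-# OPTIONS --safe #-}
module Submission where

-- Restricting a feasible point of G to V(G − v₀) keeps it feasible, and a feasible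
-- point z of G − v₀ extends to one of G by giving v₀ the value −‖z‖₁, which is low
-- enough for every edge at v₀ (G has no loops at v₀). Applying either map to the
-- points of a convex combination, with the same weights, moves P(G) onto
-- P(G − v₀) and back, compatibly with the projection.

open import Defs
open import Data.Nat using (ℕ; suc)
open import Data.Fin using (Fin)
open import Data.Rational using (ℚ)
open import Data.Product using (Σ; _×_)
open import Relation.Binary.PropositionalEquality using (_≡_)

import Data.Nat as ℕ
import Data.Nat.Properties as ℕ
open import Data.Fin using (zero; suc; punchIn; punchOut; _≟_)
open import Data.Fin.Properties using (punchIn-punchOut)
open import Data.Integer as ℤ using (ℤ; +_; -[1+_]; -_; ∣_∣; 0ℤ; -≤+; +≤+)
import Data.Integer.Properties as ℤ
import Data.Rational as ℚ
open import Data.List using (List; map)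
open import Data.List.Properties using (map-∘; map-cong)
import Data.List.Relation.Unary.All as All
import Data.List.Relation.Unary.All.Properties as All
open import Data.Vec.Functional using (insertAt)
open import Data.Vec.Functional.Properties using (insertAt-lookup; insertAt-punchIn)
open import Data.Product using (_,_; proj₁; proj₂; map₂)
open import Data.Bool using (true)
open import Data.Empty using (⊥-elim)
open import Function using (_∘_; id)
open import Relation.Binary.PropositionalEquality using (refl; sym; trans; cong; subst)
open import Relation.Nullary using (yes; no; ¬_)

∥_∥₁ : ∀ {n} → (Fin n → ℤ) → ℕ
∥_∥₁ {ℕ.zero} z = 0
∥_∥₁ {suc n}  z = ∣ z zero ∣ ℕ.+ ∥ z ∘ suc ∥₁

∣zᵢ∣≤∥z∥₁ : ∀ {n} (z : Fin n → ℤ) i → ∣ z i ∣ ℕ.≤ ∥ z ∥₁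
∣zᵢ∣≤∥z∥₁ z zero    = ℕ.m≤m+n _ _
∣zᵢ∣≤∥z∥₁ z (suc i) = ℕ.≤-trans (∣zᵢ∣≤∥z∥₁ (z ∘ suc) i) (ℕ.m≤n+m _ _)

i≤+∣i∣ : ∀ i → i ℤ.≤ + ∣ i ∣
i≤+∣i∣ (+ k)    = ℤ.≤-refl
i≤+∣i∣ -[1+ k ] = -≤+

∣i∣≤m⇒-m+i≤0 : ∀ {m} i → ∣ i ∣ ℕ.≤ m → - + m ℤ.+ i ℤ.≤ 0ℤ
∣i∣≤m⇒-m+i≤0 {m} i ∣i∣≤m = begin
  - + m ℤ.+ i     ≤⟨ ℤ.+-monoʳ-≤ (- + m) (ℤ.≤-trans (i≤+∣i∣ i) (+≤+ ∣i∣≤m)) ⟩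
  - + m ℤ.+ + m   ≡⟨ ℤ.+-inverseˡ (+ m) ⟩
  0ℤ              ∎
  where open ℤ.≤-Reasoning

-∥z∥₁+zᵢ≤1 : ∀ {n} (z : Fin n → ℤ) i → - + ∥ z ∥₁ ℤ.+ z i ℤ.≤ ℤ.+ 1
-∥z∥₁+zᵢ≤1 z i = ℤ.≤-trans (∣i∣≤m⇒-m+i≤0 (z i) (∣zᵢ∣≤∥z∥₁ z i)) (+≤+ ℕ.z≤n)

data PunchInView {n} (i : Fin (suc n)) : Fin (suc n) → Set where
  at-i    : PunchInView i i
  punched : ∀ j → PunchInView i (punchIn i j)

punchInView : ∀ {n} (i j : Fin (suc n)) → PunchInView i j
punchInView i j with i ≟ j
... | yes refl = at-i
... | no i≢j   = subst (PunchInView i) (punchIn-punchOut i≢j) (punched (punchOut i≢j))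

combination : ∀ {n} → List (ℚ × (Fin n → ℤ)) → Fin n → ℚ
combination cs i = sumℚ (map (λ c → proj₁ c ℚ.* (proj₂ c i ℚ./ 1)) cs)

module _ {k m l : ℕ} (f : (Fin m → ℤ) → Fin k → ℤ) (g : Fin l → Fin k) (h : Fin l → Fin m)
         (f-coord : ∀ x i → f x (g i) ≡ x (h i)) where

  combination-map₂ : ∀ cs i → combination (map (map₂ f) cs) (g i) ≡ combination cs (h i)
  combination-map₂ cs i = cong sumℚ (trans (sym (map-∘ cs))
    (map-cong (λ c → cong (λ t → proj₁ c ℚ.* (t ℚ./ 1)) (f-coord (proj₂ c) i)) cs))

  InConv-map : ∀ {S : (Fin m → ℤ) → Set} {T : (Fin k → ℤ) → Set} {y} →
               (∀ {x} → S x → T (f x)) →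
               InConv S y → Σ (Fin k → ℚ) λ z → InConv T z × (∀ i → z (g i) ≡ y (h i))
  InConv-map S⇒T (cs , nonneg , inS , weights≡1 , y≡) =
    combination cs′
    , (cs′ , All.map⁺ nonneg , All.map⁺ (All.map S⇒T inS)
      , trans (cong sumℚ (sym (map-∘ cs))) weights≡1 , λ _ → refl)
    , λ i → trans (combination-map₂ cs i) (sym (y≡ (h i)))
    where cs′ = map (map₂ f) cs

InConv-cong : ∀ {n} {S : (Fin n → ℤ) → Set} {y y′} →
              (∀ i → y i ≡ y′ i) → InConv S y → InConv S y′
InConv-cong y≡y′ (cs , nonneg , inS , weights≡1 , y≡) =
  cs , nonneg , inS , weights≡1 , λ i → trans (sym (y≡y′ i)) (y≡ i)

Feasible-restrict : ∀ {n} (E : Graph (suc n)) v₀ {x} →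
                    Feasible E x → Feasible (delete E v₀) (x ∘ punchIn v₀)
Feasible-restrict E v₀ feasible v w = feasible (punchIn v₀ v) (punchIn v₀ w)

Feasible-insertAt : ∀ {n} (E : Graph (suc n)) → (∀ v → ¬ E v v ≡ true) →
                    ∀ v₀ {z a} → Feasible (delete E v₀) z → (∀ j → a ℤ.+ z j ℤ.≤ ℤ.+ 1) →
                    Feasible E (insertAt z v₀ a)
Feasible-insertAt E irreflexive v₀ {z} {a} feasible a+z≤1 v w vw
  with punchInView v₀ v | punchInView v₀ w
... | at-i      | at-i      = ⊥-elim (irreflexive v₀ vw)
... | at-i      | punched j
  rewrite insertAt-lookup z v₀ a | insertAt-punchIn z v₀ a j = a+z≤1 j
... | punched i | at-i
  rewrite insertAt-lookup z v₀ a | insertAt-punchIn z v₀ a i | ℤ.+-comm (z i) a = a+z≤1 i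
... | punched i | punched j
  rewrite insertAt-punchIn z v₀ a i | insertAt-punchIn z v₀ a j = feasible i j vw

lemma3 : (n : ℕ) (E : Graph (suc n)) → IsSimple E → (v0 : Fin (suc n)) →
         (y : Fin n → ℚ) →
         ((Σ (Fin (suc n) → ℚ) λ x → P E x × (∀ i → project v0 x i ≡ y i)) → P (delete E v0) y)
         × (P (delete E v0) y → Σ (Fin (suc n) → ℚ) λ x → P E x × (∀ i → project v0 x i ≡ y i))
lemma3 n E (irreflexive , _) v0 y = projection⊆ , ⊆projection
  where
  projection⊆ : (Σ (Fin (suc n) → ℚ) λ x → P E x × (∀ i → project v0 x i ≡ y i)) →
                P (delete E v0) y
  projection⊆ (x , x∈P , x↾≡y)
    with InConv-map (_∘ punchIn v0) id (punchIn v0) (λ _ _ → refl)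
                    (λ {x} → Feasible-restrict E v0 {x}) x∈P
  ... | z , z∈P , z≡x↾ = InConv-cong (λ i → trans (z≡x↾ i) (x↾≡y i)) z∈P

  lift : (Fin n → ℤ) → Fin (suc n) → ℤ
  lift z = insertAt z v0 (- + ∥ z ∥₁)

  ⊆projection : P (delete E v0) y →
                Σ (Fin (suc n) → ℚ) λ x → P E x × (∀ i → project v0 x i ≡ y i)
  ⊆projection = InConv-map lift (punchIn v0) id (λ z → insertAt-punchIn z v0 _)
    (λ {z} feasible → Feasible-insertAt E irreflexive v0 feasible (-∥z∥₁+zᵢ≤1 z))
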